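{- Let $\varphi$ be a prime and $x>1$ an integer, and let $\omega_\varphi$ be the number of distinct prime factors of $x^\varphi-1$. Then $$x\;\ge\;\min_{0\le k<\omega_\varphi}\left[\max\left\{1+\prod_{i=1}^{k}r_{i,0},\ \left(1+\prod_{i=1}^{k}r_{i,0}\prod_{j=1}^{\omega_\varphi-k}r_{j,1}\right)^{1/\varphi}\right\}\right],$$ where only those $k$ with $k\le|\Pi_\varphi^0|$ are admitted in the minimum.
   Context: $\Pi_\varphi^0$ is the set of primes $\rho$ with $\rho\not\equiv1\pmod\varphi$ and $\Pi_\varphi^1$ the set of primes $\rho$ with $\rho\equiv1\pmod\varphi$. $r_{i,0}$ and $r_{i,1}$ denote the $i$-th smallest elements of $\Pi_\varphi^0$ and $\Pi_\varphi^1$ respectively. Empty products equal $1$. -}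

module Defs where

open import Data.Nat using (ℕ; zero; suc; _+_; _*_; _∸_; _^_; _≤_; _<_)
open import Data.Nat.Primality using (Prime; prime?)
open import Data.Nat.Divisibility using (_∣_; _∣?_)
open import Data.Fin using (Fin; toℕ)
import Data.Fin as F
open import Data.List using (List; length; filter; upTo)
open import Data.Product using (_×_)
open import Relation.Nullary using (¬_)
open import Relation.Nullary.Decidable using (_×-dec_; ¬?)
open import Level using (0ℓ)
open import Relation.Unary using (Pred; Decidable)
open import Relation.Binary.PropositionalEquality using (_≡_)

∏ : (k : ℕ) → (Fin k → ℕ) → ℕ
∏ zero    f = 1
∏ (suc k) f = f F.zero * ∏ k (λ i → f (F.suc i))

countBelow : {P : Pred ℕ 0ℓ} → Decidable P → ℕ → ℕ
countBelow P? n = length (filter P? (upTo n))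

-- r is the (i+1)-th smallest element of P  (0-indexed i):
-- r ∈ P and exactly i elements of P are smaller than r.
IsNth : {P : Pred ℕ 0ℓ} → Decidable P → ℕ → ℕ → Set
IsNth {P} P? i r = P r × countBelow P? r ≡ i

PrimeFactorOf : ℕ → Pred ℕ 0ℓ
PrimeFactorOf n p = Prime p × p ∣ n

primeFactorOf? : (n : ℕ) → Decidable (PrimeFactorOf n)
primeFactorOf? n p = prime? p ×-dec (p ∣? n)

ω : ℕ → ℕ
ω n = length (filter (primeFactorOf? n) (upTo (suc n)))

-- Π¹_φ : primes ρ with ρ ≡ 1 (mod φ)   (for a prime ρ ≥ 2 this is φ ∣ ρ ∸ 1)
Π¹ : ℕ → Pred ℕ 0ℓ
Π¹ φ ρ = Prime ρ × φ ∣ (ρ ∸ 1)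

Π¹? : (φ : ℕ) → Decidable (Π¹ φ)
Π¹? φ ρ = prime? ρ ×-dec (φ ∣? (ρ ∸ 1))

Π⁰ : ℕ → Pred ℕ 0ℓ
Π⁰ φ ρ = Prime ρ × ¬ (φ ∣ (ρ ∸ 1))

Π⁰? : (φ : ℕ) → Decidable (Π⁰ φ)
Π⁰? φ ρ = prime? ρ ×-dec ¬? (φ ∣? (ρ ∸ 1))

{-# OPTIONS --safe #-}
module Submission where

-- Let N = x ^ φ ∸ 1. A prime p ∣ N with p ≢ 1 (mod φ) divides x ∸ 1: by Fermat the order of x
-- modulo p divides both φ and p ∸ 1, which are coprime. So the product of the ω⁰ prime factors of
-- N lying in Π⁰ divides x ∸ 1, and the product of all ω prime factors divides N; replacing the
-- i-th of them by the i-th element of Π⁰ (resp. Π¹) only makes the products smaller, so k = ω⁰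
-- satisfies both bounds, and it is admissible as soon as some prime factor lies in Π¹.
-- If none does, every prime factor of G = 1 + x + ⋯ + x ^ (φ ∸ 1) divides x ∸ 1 and hence φ,
-- since G ≡ φ (mod x ∸ 1); as G > φ this gives φ * φ ∣ G. For odd φ that contradicts
-- G ≡ φ (mod φ * φ), and for φ = 2 it leaves only x = 3, where k = 0 works.

open import Defs
open import Data.Nat using (ℕ; suc; _+_; _*_; _∸_; _^_; _≤_; _<_)
open import Data.Nat.Primality using (Prime)
open import Data.Fin using (Fin; toℕ)
open import Data.Product using (Σ; _×_; ∃-syntax)

open import Data.Fin using (zero; suc; inject₁; fromℕ)
open import Data.Fin.Properties using (toℕ<n; toℕ-inject₁; toℕ-fromℕ)
open import Data.List using (length; filter; upTo; []; _∷_; [_]; _++_)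
open import Data.List.Properties using (filter-++; length-++; upTo-∷ʳ)
open import Data.List.Relation.Unary.All using (_∷_)
open import Data.Nat using (zero; z≤n; s≤s; z<s; NonZero; >-nonZero; nonTrivial⇒n>1; _!; _%_; _/_; _≟_; _≤?_; _<?_)
open import Data.Nat.Combinatorics using (_C_; nCk≡n!/k![n-k]!; k![n∸k]!∣n!; nCn≡1)
open import Data.Nat.Coprimality as Coprimality using (Coprime; coprime⇒gcd≡1; coprime-Bézout)
open import Data.Nat.DivMod
open import Data.Nat.Divisibility
open import Data.Nat.GCD using (module Bézout)
open import Data.Nat.LCM using (lcm; lcm-least; gcd*lcm)
open import Data.Nat.ListAction using (product)
open import Data.Nat.Primality using (¬prime[0]; ¬prime[1]; prime⇒nonZero; prime⇒nonTrivial; prime⇒irreducible; euclidsLemma; prime?)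
open import Data.Nat.Primality.Factorisation using (factorise)
open import Data.Nat.Properties
open import Data.Nat.Tactic.RingSolver using (solve-∀)
open import Data.Product using (_,_; proj₁; proj₂)
open import Data.Sum using (_⊎_; inj₁; inj₂; [_,_]′)
open import Data.Vec.Functional using (init; tail)
open import Function using (_∘_)
open import Level using (0ℓ)
open import Relation.Binary.Bundles using (Setoid)
import Relation.Binary.Construct.On as On
open import Relation.Binary.PropositionalEquality hiding ([_])
import Relation.Binary.Reasoning.Setoid as SetoidReasoning
open import Relation.Nullary using (¬_; Dec; yes; no; contradiction)
open import Relation.Nullary.Decidable using (from-yes; from-no)
open import Relation.Unary using (Pred; Decidable; _⊆_; _∩_)
open import Relation.Unary.Properties using (_∩?_)

open import Algebra.Properties.CommutativeSemigroup +-commutativeSemigroup using () renaming (interchange to +-interchange)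
import Algebra.Definitions.RawMonoid Data.Nat.+-0-rawMonoid as Additive
import Algebra.Properties.CommutativeSemiring.Binomial +-*-commutativeSemiring as Binomial
open import Algebra.Properties.Monoid.Sum +-0-monoid using (sum; sum-init-last; sum-cong-≗)
import Algebra.Properties.Semiring.Exp +-*-semiring as Semiring

prime∤1 : ∀ {p} → Prime p → ¬ p ∣ 1
prime∤1 p-prime p∣1 = ¬prime[1] (subst Prime (∣1⇒≡1 p∣1) p-prime)

prime>1 : ∀ {p} → Prime p → 1 < p
prime>1 {p} p-prime = nonTrivial⇒n>1 p {{prime⇒nonTrivial p-prime}}

prime∤⇒coprime : ∀ {p n} → Prime p → ¬ p ∣ n → Coprime p n
prime∤⇒coprime p-prime p∤n (d∣p , d∣n) with prime⇒irreducible p-prime d∣p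
... | inj₁ d≡1  = d≡1
... | inj₂ refl = contradiction d∣n p∤n

coprime⇒*∣ : ∀ {m n c} → Coprime m n → m ∣ c → n ∣ c → m * n ∣ c
coprime⇒*∣ {m} {n} coprime m∣c n∣c = subst (_∣ _) lcm≡m*n (lcm-least m∣c n∣c)
  where
  lcm≡m*n : lcm m n ≡ m * n
  lcm≡m*n = trans (sym (+-identityʳ (lcm m n)))
                  (trans (cong (_* lcm m n) (sym (coprime⇒gcd≡1 coprime))) (gcd*lcm m n))

prime-factor : ∀ {n} → 1 < n → ∃[ p ] Prime p × p ∣ n
prime-factor {n@(suc _)} 1<n with factorise n
... | record { factors = [] ; isFactorisation = n≡1 } = contradiction n≡1 (>⇒≢ 1<n)
... | record { factors = p ∷ ps ; isFactorisation = n≡p*∏ps ; factorsPrime = p-prime ∷ _ } =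
  p , p-prime , divides (product ps) (trans n≡p*∏ps (*-comm p (product ps)))

prime-power>p⇒p*p∣ : ∀ {p n} → Prime p → (∀ {q} → Prime q → q ∣ n → q ≡ p) → p < n → p * p ∣ n
prime-power>p⇒p*p∣ {p} {n} p-prime only-p p<n =
  subst (p * p ∣_) (sym (m∣n⇒n≡m*quotient p∣n)) (*-monoʳ-∣ p p∣n/p)
  where
  p∣n : p ∣ n
  p∣n with prime-factor (<-trans (prime>1 p-prime) p<n)
  ... | q , q-prime , q∣n = subst (_∣ n) (only-p q-prime q∣n) q∣n
  p∣n/p : p ∣ quotient p∣n
  p∣n/p with prime-factor (quotient>1 p∣n p<n)
  ... | q , q-prime , q∣n/p = subst (_∣ quotient p∣n) (only-p q-prime (∣-trans q∣n/p (quotient-∣ p∣n))) q∣n/p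

2∣n⊎2∣1+n : ∀ n → 2 ∣ n ⊎ 2 ∣ suc n
2∣n⊎2∣1+n zero    = inj₁ (2 ∣0)
2∣n⊎2∣1+n (suc n) = [ inj₂ ∘ ∣m∣n⇒∣m+n (∣-refl {2}) , inj₁ ]′ (2∣n⊎2∣1+n n)

prime∧2∤[p∸1]⇒p≡2 : ∀ {p} → Prime p → ¬ 2 ∣ p ∸ 1 → p ≡ 2
prime∧2∤[p∸1]⇒p≡2 {suc p} p-prime 2∤p with 2∣n⊎2∣1+n p
... | inj₁ 2∣p   = contradiction 2∣p 2∤p
... | inj₂ 2∣1+p with prime⇒irreducible p-prime 2∣1+p
...   | inj₁ ()
...   | inj₂ 2≡1+p = sym 2≡1+p

prime∤m! : ∀ {p m} → Prime p → m < p → ¬ p ∣ m !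
prime∤m! {m = zero}  p-prime _   = prime∤1 p-prime
prime∤m! {m = suc m} p-prime m<p p∣m! with euclidsLemma (suc m) (m !) p-prime p∣m!
... | inj₁ p∣1+m = <⇒≱ m<p (∣⇒≤ p∣1+m)
... | inj₂ p∣m!  = prime∤m! p-prime (<-trans (n<1+n m) m<p) p∣m!

prime∣pCk : ∀ {p k} → Prime p → 0 < k → k < p → p ∣ p C k
prime∣pCk {p@(suc q)} {k} p-prime 0<k k<p
  with euclidsLemma (p C k) (k ! * (p ∸ k) !) p-prime p∣pCk*k!*[p∸k]!
  where
  instance _ = k !* (p ∸ k) !≢0
  pCk*k!*[p∸k]!≡p! : (p C k) * (k ! * (p ∸ k) !) ≡ p !
  pCk*k!*[p∸k]!≡p! = trans (cong (_* (k ! * (p ∸ k) !)) (nCk≡n!/k![n-k]! (<⇒≤ k<p)))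
                           (m/n*n≡m (k![n∸k]!∣n! (<⇒≤ k<p)))
  p∣pCk*k!*[p∸k]! : p ∣ (p C k) * (k ! * (p ∸ k) !)
  p∣pCk*k!*[p∸k]! = subst (p ∣_) (sym pCk*k!*[p∸k]!≡p!) (m∣m*n (q !))
... | inj₁ p∣pCk = p∣pCk
... | inj₂ p∣k!*[p∸k]! with euclidsLemma (k !) ((p ∸ k) !) p-prime p∣k!*[p∸k]!
...   | inj₁ p∣k!     = contradiction p∣k! (prime∤m! p-prime k<p)
...   | inj₂ p∣[p∸k]! = contradiction p∣[p∸k]! (prime∤m! p-prime (∸-monoʳ-< 0<k (<⇒≤ k<p)))

-- Fermat's little theorem and the order argument

module Congruence (n : ℕ) .{{_ : NonZero n}} where

  setoid-mod : Setoid 0ℓ 0ℓ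
  setoid-mod = On.setoid (setoid ℕ) (_% n)

  open Setoid setoid-mod public using (_≈_) renaming (refl to ≈-refl; trans to ≈-trans)
  module ≈-Reasoning = SetoidReasoning setoid-mod

  +-cong : ∀ {a b c d} → a ≈ b → c ≈ d → a + c ≈ b + d
  +-cong {a} {b} {c} {d} a≈b c≈d = begin
    (a + c) % n            ≡⟨ %-distribˡ-+ a c n ⟩
    (a % n + c % n) % n    ≡⟨ cong₂ (λ u v → (u + v) % n) a≈b c≈d ⟩
    (b % n + d % n) % n    ≡⟨ %-distribˡ-+ b d n ⟨
    (b + d) % n            ∎
    where open ≡-Reasoning

  *-cong : ∀ {a b c d} → a ≈ b → c ≈ d → a * c ≈ b * d
  *-cong {a} {b} {c} {d} a≈b c≈d = begin
    (a * c) % n            ≡⟨ %-distribˡ-* a c n ⟩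
    (a % n * (c % n)) % n  ≡⟨ cong₂ (λ u v → (u * v) % n) a≈b c≈d ⟩
    (b % n * (d % n)) % n  ≡⟨ %-distribˡ-* b d n ⟨
    (b * d) % n            ∎
    where open ≡-Reasoning

  ^-congˡ : ∀ {a b} k → a ≈ b → a ^ k ≈ b ^ k
  ^-congˡ zero    a≈b = ≈-refl
  ^-congˡ (suc k) a≈b = *-cong a≈b (^-congˡ k a≈b)

  ≈1⇒^≈1 : ∀ {a} k → a ≈ 1 → a ^ k ≈ 1
  ≈1⇒^≈1 k a≈1 = ≈-trans (^-congˡ k a≈1) (cong (_% n) (^-zeroˡ k))

  +-*-absorbʳ : ∀ a k → a + k * n ≈ a
  +-*-absorbʳ a k = [m+kn]%n≡m%n a k n

  ∣∸⇒≈ : ∀ {a b} → b ≤ a → n ∣ a ∸ b → a ≈ b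
  ∣∸⇒≈ {a} {b} b≤a (divides k a∸b≡k*n) = begin
    a            ≡⟨ m+[n∸m]≡n b≤a ⟨
    b + (a ∸ b)  ≡⟨ cong (b +_) a∸b≡k*n ⟩
    b + k * n    ≈⟨ +-*-absorbʳ b k ⟩
    b            ∎
    where open ≈-Reasoning

  ≈⇒∣∸ : ∀ {a b} → a ≈ b → b ≤ a → n ∣ a ∸ b
  ≈⇒∣∸ {a} {b} a≈b b≤a = divides (a / n ∸ b / n) (begin
    a ∸ b                                      ≡⟨ cong₂ _∸_ (m≡m%n+[m/n]*n a n) (m≡m%n+[m/n]*n b n) ⟩
    (a % n + a / n * n) ∸ (b % n + b / n * n)  ≡⟨ cong (λ r → (a % n + a / n * n) ∸ (r + b / n * n)) a≈b ⟨
    (a % n + a / n * n) ∸ (a % n + b / n * n)  ≡⟨ [m+n]∸[m+o]≡n∸o (a % n) (a / n * n) (b / n * n) ⟩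
    a / n * n ∸ b / n * n                      ≡⟨ *-distribʳ-∸ n (a / n) (b / n) ⟨
    (a / n ∸ b / n) * n                        ∎)
    where open ≡-Reasoning

binomial-theorem : ∀ n a → (1 + a) ^ n ≡ sum (λ (k : Fin (suc n)) → (n C toℕ k) * a ^ (n ∸ toℕ k))
binomial-theorem n a = begin
  (1 + a) ^ n                        ≡⟨ ^≡^ (1 + a) n ⟨
  (1 + a) Semiring.^ n               ≡⟨ Binomial.theorem n 1 a ⟩
  sum (Binomial.binomialTerm 1 a n)  ≡⟨ sum-cong-≗ term≡ ⟩
  sum (λ (k : Fin (suc n)) → (n C toℕ k) * a ^ (n ∸ toℕ k)) ∎
  where
  open ≡-Reasoning
  ×≡* : ∀ m b → m Additive.× b ≡ m * b
  ×≡* zero    b = refl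
  ×≡* (suc m) b = cong (b +_) (×≡* m b)
  ^≡^ : ∀ b m → b Semiring.^ m ≡ b ^ m
  ^≡^ b zero    = refl
  ^≡^ b (suc m) = cong (b *_) (^≡^ b m)
  term≡ : ∀ k → Binomial.binomialTerm 1 a n k ≡ (n C toℕ k) * a ^ (n ∸ toℕ k)
  term≡ k = begin
    (n C toℕ k) Additive.× (1 Semiring.^ toℕ k * a Semiring.^ (n ∸ toℕ k))
      ≡⟨ ×≡* (n C toℕ k) _ ⟩
    (n C toℕ k) * (1 Semiring.^ toℕ k * a Semiring.^ (n ∸ toℕ k))
      ≡⟨ cong₂ (λ u v → (n C toℕ k) * (u * v)) (trans (^≡^ 1 (toℕ k)) (^-zeroˡ (toℕ k))) (^≡^ a (n ∸ toℕ k)) ⟩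
    (n C toℕ k) * (1 * a ^ (n ∸ toℕ k))
      ≡⟨ cong ((n C toℕ k) *_) (*-identityˡ _) ⟩
    (n C toℕ k) * a ^ (n ∸ toℕ k) ∎

∣-sum : ∀ {d n} (f : Fin n → ℕ) → (∀ i → d ∣ f i) → d ∣ sum f
∣-sum {d} {zero}  f d∣f = d ∣0
∣-sum {d} {suc n} f d∣f = ∣m∣n⇒∣m+n (d∣f zero) (∣-sum (tail f) (d∣f ∘ suc))

freshman's-dream : ∀ {p} → Prime p → ∀ a → ∃[ m ] (1 + a) ^ p ≡ (1 + a ^ p) + m * p
freshman's-dream {zero}      p-prime a = contradiction p-prime ¬prime[0]
freshman's-dream {p@(suc q)} p-prime a = quotient p∣middle , (begin
  (1 + a) ^ p                                    ≡⟨ binomial-theorem p a ⟩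
  T zero + sum (tail T)                          ≡⟨ cong (T zero +_) (sum-init-last (tail T)) ⟩
  T zero + (sum (init (tail T)) + T (fromℕ p))   ≡⟨ cong₂ (λ u v → u + (v + T (fromℕ p))) (*-identityˡ (a ^ p)) (m∣n⇒n≡quotient*m p∣middle) ⟩
  a ^ p + (quotient p∣middle * p + T (fromℕ p))  ≡⟨ cong (λ v → a ^ p + (quotient p∣middle * p + v)) T[p]≡1 ⟩
  a ^ p + (quotient p∣middle * p + 1)            ≡⟨ cong (a ^ p +_) (+-comm _ 1) ⟩
  a ^ p + suc (quotient p∣middle * p)            ≡⟨ +-suc (a ^ p) _ ⟩
  (1 + a ^ p) + quotient p∣middle * p            ∎)
  where
  open ≡-Reasoning
  T : Fin (suc p) → ℕ
  T k = (p C toℕ k) * a ^ (p ∸ toℕ k)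
  p∣middle : p ∣ sum (init (tail T))
  p∣middle = ∣-sum (init (tail T)) λ i →
    ∣m⇒∣m*n _ (prime∣pCk p-prime (s≤s z≤n) (s≤s (subst (_< q) (sym (toℕ-inject₁ i)) (toℕ<n i))))
  T[p]≡1 : T (fromℕ p) ≡ 1
  T[p]≡1 = trans (cong (λ k → (p C k) * a ^ (p ∸ k)) (toℕ-fromℕ p))
                 (cong₂ (λ c e → c * a ^ e) (nCn≡1 p) (n∸n≡0 p))

module _ {p} (p-prime : Prime p) where

  private instance _ = prime⇒nonZero p-prime
  open Congruence p

  fermat's-little-theorem : ∀ a → a ^ p ≈ a
  fermat's-little-theorem zero    = cong (λ e → 0 ^ e % p) (sym (suc-pred p))
  fermat's-little-theorem (suc a) with freshman's-dream p-prime a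
  ... | m , [1+a]^p≡ = begin
    (1 + a) ^ p          ≡⟨ [1+a]^p≡ ⟩
    (1 + a ^ p) + m * p  ≈⟨ +-*-absorbʳ (1 + a ^ p) m ⟩
    1 + a ^ p            ≈⟨ +-cong {1} ≈-refl (fermat's-little-theorem a) ⟩
    1 + a                ∎
    where open ≈-Reasoning

  ^[1+m[p∸1]]≈ : ∀ a m → a ^ (1 + m * (p ∸ 1)) ≈ a
  ^[1+m[p∸1]]≈ a zero    = cong (_% p) (*-identityʳ a)
  ^[1+m[p∸1]]≈ a (suc m) = begin
    a ^ (1 + (p ∸ 1 + m * (p ∸ 1)))      ≡⟨ cong (a ^_) (+-suc (p ∸ 1) (m * (p ∸ 1))) ⟨
    a ^ (p ∸ 1 + (1 + m * (p ∸ 1)))      ≡⟨ ^-distribˡ-+-* a (p ∸ 1) (1 + m * (p ∸ 1)) ⟩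
    a ^ (p ∸ 1) * a ^ (1 + m * (p ∸ 1))  ≈⟨ *-cong {a ^ (p ∸ 1)} ≈-refl (^[1+m[p∸1]]≈ a m) ⟩
    a ^ (p ∸ 1) * a                      ≡⟨ *-comm (a ^ (p ∸ 1)) a ⟩
    a ^ suc (p ∸ 1)                      ≡⟨ cong (a ^_) (suc-pred p) ⟩
    a ^ p                                ≈⟨ fermat's-little-theorem a ⟩
    a                                    ∎
    where open ≈-Reasoning

  -- Bézout for φ and p ∸ 1 yields x ≈ 1 or x * x ≈ x; either way p ∣ x * (x ∸ 1).
  ∣x^φ∸1⇒∣x∸1 : ∀ {φ} x → Prime φ → ¬ φ ∣ p ∸ 1 → p ∣ x ^ φ ∸ 1 → p ∣ x ∸ 1
  ∣x^φ∸1⇒∣x∸1 zero _ _ _ = p ∣0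
  ∣x^φ∸1⇒∣x∸1 {φ} x@(suc _) φ-prime φ∤p∸1 p∣x^φ∸1 with euclidsLemma x (x ∸ 1) p-prime p∣x*[x∸1]
    where
    open ≈-Reasoning
    x^[φ*u]≈1 : ∀ u → x ^ (φ * u) ≈ 1
    x^[φ*u]≈1 u = ≈-trans (cong (_% p) (sym (^-*-assoc x φ u))) (≈1⇒^≈1 u (∣∸⇒≈ (m^n>0 x φ) p∣x^φ∸1))
    x*x≈x*1 : x * x ≈ x * 1
    x*x≈x*1 with coprime-Bézout (prime∤⇒coprime φ-prime φ∤p∸1)
    ... | Bézout.+- u v 1+v[p∸1]≡uφ = *-cong {x} ≈-refl (begin
      x                      ≈⟨ ^[1+m[p∸1]]≈ x v ⟨
      x ^ (1 + v * (p ∸ 1))  ≡⟨ cong (x ^_) (trans 1+v[p∸1]≡uφ (*-comm u φ)) ⟩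
      x ^ (φ * u)            ≈⟨ x^[φ*u]≈1 u ⟩
      1                      ∎)
    ... | Bézout.-+ u v 1+uφ≡v[p∸1] = begin
      x * x                  ≡⟨ *-identityʳ (x * x) ⟨
      x * x * 1              ≈⟨ *-cong {x * x} ≈-refl (x^[φ*u]≈1 u) ⟨
      x * x * x ^ (φ * u)    ≡⟨ *-assoc x x (x ^ (φ * u)) ⟩
      x ^ (2 + φ * u)        ≡⟨ cong (λ e → x ^ (1 + e)) (trans (cong (1 +_) (*-comm φ u)) 1+uφ≡v[p∸1]) ⟩
      x ^ (1 + v * (p ∸ 1))  ≈⟨ ^[1+m[p∸1]]≈ x v ⟩
      x                      ≡⟨ *-identityʳ x ⟨
      x * 1                  ∎
    p∣x*[x∸1] : p ∣ x * (x ∸ 1)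
    p∣x*[x∸1] = subst (p ∣_) (sym (*-distribˡ-∸ x x 1)) (≈⇒∣∸ x*x≈x*1 (*-monoʳ-≤ x (s≤s z≤n)))
  ... | inj₂ p∣x∸1 = p∣x∸1
  ... | inj₁ p∣x   = contradiction (∣m+n∣m⇒∣n p∣[x^φ∸1]+1 p∣x^φ∸1) (prime∤1 p-prime)
    where
    p∣[x^φ∸1]+1 : p ∣ (x ^ φ ∸ 1) + 1
    p∣[x^φ∸1]+1 = subst (p ∣_) (trans (cong (x ^_) (suc-pred φ {{prime⇒nonZero φ-prime}})) (sym (m∸n+n≡m (m^n>0 x φ))))
                        (∣m⇒∣m*n _ p∣x)

-- Counting and multiplying the elements of a decidable set below a bound

∏-init-last : ∀ {k} (f : Fin (suc k) → ℕ) → ∏ (suc k) f ≡ ∏ k (f ∘ inject₁) * f (fromℕ k)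
∏-init-last {zero}  f = trans (*-identityʳ (f zero)) (sym (*-identityˡ (f zero)))
∏-init-last {suc k} f = trans (cong (f zero *_) (∏-init-last (f ∘ suc))) (sym (*-assoc (f zero) _ _))

indicator : ∀ {A : Set} → Dec A → ℕ
indicator (yes _) = 1
indicator (no _)  = 0

prodBelow : {P : Pred ℕ 0ℓ} → Decidable P → ℕ → ℕ
prodBelow P? zero    = 1
prodBelow P? (suc n) = prodBelow P? n * n ^ indicator (P? n)

module _ {P : Pred ℕ 0ℓ} (P? : Decidable P) where

  countBelow-suc : ∀ n → countBelow P? (suc n) ≡ countBelow P? n + indicator (P? n)
  countBelow-suc n = begin
    length (filter P? (upTo (suc n)))               ≡⟨ cong (length ∘ filter P?) (upTo-∷ʳ n) ⟨
    length (filter P? (upTo n ++ [ n ]))            ≡⟨ cong length (filter-++ P? (upTo n) [ n ]) ⟩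
    length (filter P? (upTo n) ++ filter P? [ n ])  ≡⟨ length-++ (filter P? (upTo n)) ⟩
    countBelow P? n + length (filter P? [ n ])      ≡⟨ cong (countBelow P? n +_) length-filter-[n] ⟩
    countBelow P? n + indicator (P? n)              ∎
    where
    open ≡-Reasoning
    length-filter-[n] : length (filter P? [ n ]) ≡ indicator (P? n)
    length-filter-[n] with P? n
    ... | yes _ = refl
    ... | no  _ = refl

  countBelow-suc-∈ : ∀ {n} → P n → countBelow P? (suc n) ≡ suc (countBelow P? n)
  countBelow-suc-∈ {n} Pn with P? n | countBelow-suc n
  ... | yes _  | c[1+n]≡ = trans c[1+n]≡ (+-comm (countBelow P? n) 1)
  ... | no ¬Pn | _       = contradiction Pn ¬Pn

  countBelow-monoʳ-≤ : ∀ {m n} → m ≤ n → countBelow P? m ≤ countBelow P? n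
  countBelow-monoʳ-≤ {n = zero}  z≤n = ≤-refl
  countBelow-monoʳ-≤ {m} {suc n} m≤1+n with m≤n⇒m<n∨m≡n m≤1+n
  ... | inj₂ refl  = ≤-refl
  ... | inj₁ m<1+n = ≤-trans (countBelow-monoʳ-≤ (≤-pred m<1+n))
                             (subst (countBelow P? n ≤_) (sym (countBelow-suc n)) (m≤m+n _ _))

  countBelow-reflects-≤ : ∀ {m n} → P n → countBelow P? m ≤ countBelow P? n → m ≤ n
  countBelow-reflects-≤ {m} {n} Pn c[m]≤c[n] with m ≤? n
  ... | yes m≤n = m≤n
  ... | no  m≰n = contradiction
    (≤-trans (≤-reflexive (sym (countBelow-suc-∈ Pn))) (countBelow-monoʳ-≤ (≰⇒> m≰n))) (≤⇒≯ c[m]≤c[n])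

  countBelow-pos : ∀ {m n} → P m → m < n → 0 < countBelow P? n
  countBelow-pos Pm m<n = ≤-trans (≤-trans (s≤s z≤n) (≤-reflexive (sym (countBelow-suc-∈ Pm)))) (countBelow-monoʳ-≤ m<n)

  nth : ∀ n {i} → i < countBelow P? n → ∃[ r ] IsNth P? i r
  nth (suc n) {i} i<c[1+n] with P? n | countBelow-suc n
  ... | no _   | c[1+n]≡ = nth n (subst (i <_) (trans c[1+n]≡ (+-identityʳ _)) i<c[1+n])
  ... | yes Pn | c[1+n]≡ with i <? countBelow P? n
  ...   | yes i<c[n] = nth n i<c[n]
  ...   | no  i≮c[n] = n , Pn , ≤-antisym (≮⇒≥ i≮c[n]) (≤-pred (subst (i <_) (trans c[1+n]≡ (+-comm _ 1)) i<c[1+n]))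

  enumerate : ∀ n {k} → k ≤ countBelow P? n → Σ (Fin k → ℕ) λ r → ∀ i → IsNth P? (toℕ i) (r i)
  enumerate n k≤c = proj₁ ∘ nth-i , proj₂ ∘ nth-i
    where
    nth-i : ∀ i → ∃[ r ] IsNth P? (toℕ i) r
    nth-i i = nth n (<-≤-trans (toℕ<n i) k≤c)

module _ {P Q : Pred ℕ 0ℓ} (P? : Decidable P) (Q? : Decidable Q) (P⊆Q : P ⊆ Q) where

  countBelow-⊆ : ∀ n → countBelow P? n ≤ countBelow Q? n
  countBelow-⊆ zero    = ≤-refl
  countBelow-⊆ (suc n) = subst₂ _≤_ (sym (countBelow-suc P? n)) (sym (countBelow-suc Q? n))
    (+-mono-≤ (countBelow-⊆ n) indicator-⊆)
    where
    indicator-⊆ : indicator (P? n) ≤ indicator (Q? n)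
    indicator-⊆ with P? n | Q? n
    ... | yes Pn | no ¬Qn = contradiction (P⊆Q Pn) ¬Qn
    ... | yes _  | yes _  = ≤-refl
    ... | no  _  | _      = z≤n

  -- As P ⊆ Q, the i-th element of Q is at most the i-th element of P.
  ∏-nth≤prodBelow : (∀ {m} → P m → NonZero m) → ∀ n {k} (r : Fin k → ℕ) →
                    (∀ i → IsNth Q? (toℕ i) (r i)) → k ≤ countBelow P? n → ∏ k r ≤ prodBelow P? n
  ∏-nth≤prodBelow P≢0 zero    r r-nth z≤n = ≤-refl
  ∏-nth≤prodBelow P≢0 (suc n) {k} r r-nth k≤c[1+n] with P? n | countBelow-suc P? n
  ... | no _   | c[1+n]≡ = subst (∏ k r ≤_) (sym (*-identityʳ _))
    (∏-nth≤prodBelow P≢0 n r r-nth (subst (k ≤_) (trans c[1+n]≡ (+-identityʳ _)) k≤c[1+n]))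
  ... | yes Pn | c[1+n]≡ with k ≤? countBelow P? n
  ...   | yes k≤c[n] = ≤-trans (∏-nth≤prodBelow P≢0 n r r-nth k≤c[n]) (m≤m*n _ (n ^ 1) {{m^n≢0 n 1 {{P≢0 Pn}}}})
  ...   | no  k≰c[n] with ≤-antisym (subst (k ≤_) (trans c[1+n]≡ (+-comm _ 1)) k≤c[1+n]) (≰⇒> k≰c[n])
  ...     | refl = begin
    ∏ (suc c) r                        ≡⟨ ∏-init-last r ⟩
    ∏ c (r ∘ inject₁) * r (fromℕ c)    ≤⟨ *-mono-≤ init≤ last≤ ⟩
    prodBelow P? n * n ^ 1             ∎
    where
    open ≤-Reasoning
    c : ℕ
    c = countBelow P? n
    init≤ : ∏ c (r ∘ inject₁) ≤ prodBelow P? n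
    init≤ = ∏-nth≤prodBelow P≢0 n (r ∘ inject₁)
      (λ i → proj₁ (r-nth (inject₁ i)) , trans (proj₂ (r-nth (inject₁ i))) (toℕ-inject₁ i)) ≤-refl
    last≤ : r (fromℕ c) ≤ n ^ 1
    last≤ = subst (r (fromℕ c) ≤_) (sym (*-identityʳ n)) (countBelow-reflects-≤ Q? (P⊆Q Pn) (begin
      countBelow Q? (r (fromℕ c))  ≡⟨ proj₂ (r-nth (fromℕ c)) ⟩
      toℕ (fromℕ c)                ≡⟨ toℕ-fromℕ c ⟩
      c                            ≤⟨ countBelow-⊆ n ⟩
      countBelow Q? n              ∎))

-- The hypothesis says that P is the disjoint union of Q and R.
module _ {P Q R : Pred ℕ 0ℓ} (P? : Decidable P) (Q? : Decidable Q) (R? : Decidable R)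
         (partition : ∀ m → indicator (P? m) ≡ indicator (Q? m) + indicator (R? m)) where

  countBelow-partition : ∀ n → countBelow P? n ≡ countBelow Q? n + countBelow R? n
  countBelow-partition zero    = refl
  countBelow-partition (suc n) = begin
    countBelow P? (suc n)               ≡⟨ countBelow-suc P? n ⟩
    countBelow P? n + indicator (P? n)  ≡⟨ cong₂ _+_ (countBelow-partition n) (partition n) ⟩
    (#Q + #R) + (χQ + χR)               ≡⟨ +-interchange #Q #R χQ χR ⟩
    (#Q + χQ) + (#R + χR)               ≡⟨ cong₂ _+_ (countBelow-suc Q? n) (countBelow-suc R? n) ⟨
    countBelow Q? (suc n) + countBelow R? (suc n) ∎
    where
    open ≡-Reasoning
    #Q #R χQ χR : ℕ
    #Q = countBelow Q? n
    #R = countBelow R? n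
    χQ = indicator (Q? n)
    χR = indicator (R? n)

  prodBelow-partition : ∀ n → prodBelow P? n ≡ prodBelow Q? n * prodBelow R? n
  prodBelow-partition zero    = refl
  prodBelow-partition (suc n) = begin
    prodBelow P? n * n ^ indicator (P? n)  ≡⟨ cong₂ (λ a e → a * n ^ e) (prodBelow-partition n) (partition n) ⟩
    (∏Q * ∏R) * n ^ (χQ + χR)              ≡⟨ cong ((∏Q * ∏R) *_) (^-distribˡ-+-* n χQ χR) ⟩
    (∏Q * ∏R) * (n ^ χQ * n ^ χR)          ≡⟨ [m*n]*[o*p]≡[m*o]*[n*p] ∏Q ∏R (n ^ χQ) (n ^ χR) ⟩
    (∏Q * n ^ χQ) * (∏R * n ^ χR)          ∎
    where
    open ≡-Reasoning
    ∏Q ∏R χQ χR : ℕ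
    ∏Q = prodBelow Q? n
    ∏R = prodBelow R? n
    χQ = indicator (Q? n)
    χR = indicator (R? n)

module _ {P : Pred ℕ 0ℓ} (P? : Decidable P) (P⊆Prime : P ⊆ Prime) where

  prime∣prodBelow⇒< : ∀ {q} n → Prime q → q ∣ prodBelow P? n → q < n
  prime∣prodBelow⇒< zero q-prime q∣1 = contradiction q∣1 (prime∤1 q-prime)
  prime∣prodBelow⇒< {q} (suc n) q-prime q∣∏ with euclidsLemma (prodBelow P? n) _ q-prime q∣∏
  ... | inj₁ q∣∏   = m<n⇒m<1+n (prime∣prodBelow⇒< n q-prime q∣∏)
  ... | inj₂ q∣n^χ with P? n
  ...   | no _   = contradiction q∣n^χ (prime∤1 q-prime)
  ...   | yes Pn with prime⇒irreducible (P⊆Prime Pn) (subst (q ∣_) (*-identityʳ n) q∣n^χ)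
  ...     | inj₁ refl = contradiction q-prime ¬prime[1]
  ...     | inj₂ refl = ≤-refl

  prodBelow-∣ : ∀ {M} → P ⊆ (_∣ M) → ∀ n → prodBelow P? n ∣ M
  prodBelow-∣ P∣M zero = 1∣ _
  prodBelow-∣ P∣M (suc n) with P? n
  ... | no _   = subst (_∣ _) (sym (*-identityʳ _)) (prodBelow-∣ P∣M n)
  ... | yes Pn = subst (λ m → prodBelow P? n * m ∣ _) (sym (*-identityʳ n))
    (coprime⇒*∣ (Coprimality.sym (prime∤⇒coprime (P⊆Prime Pn) n∤∏)) (prodBelow-∣ P∣M n) (P∣M Pn))
    where
    n∤∏ : ¬ n ∣ prodBelow P? n
    n∤∏ n∣∏ = <-irrefl refl (prime∣prodBelow⇒< n (P⊆Prime Pn) n∣∏)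

-- When x ^ φ ∸ 1 has no prime factor ≡ 1 (mod φ)

geometric : ℕ → ℕ → ℕ
geometric x zero    = 0
geometric x (suc n) = 1 + x * geometric x n

triangular : ℕ → ℕ
triangular zero    = 0
triangular (suc n) = n + triangular n

1≤triangular : ∀ {n} → 2 ≤ n → 1 ≤ triangular n
1≤triangular {suc zero}    (s≤s ())
1≤triangular {suc (suc n)} _ = s≤s z≤n

2*triangular≡n*[n∸1] : ∀ n → 2 * triangular n ≡ n * (n ∸ 1)
2*triangular≡n*[n∸1] zero          = refl
2*triangular≡n*[n∸1] (suc zero)    = refl
2*triangular≡n*[n∸1] (suc (suc n)) = begin
  2 * (suc n + triangular (suc n))    ≡⟨ *-distribˡ-+ 2 (suc n) (triangular (suc n)) ⟩
  2 * suc n + 2 * triangular (suc n)  ≡⟨ cong (2 * suc n +_) (2*triangular≡n*[n∸1] (suc n)) ⟩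
  2 * suc n + suc n * n               ≡⟨ lemma n ⟩
  suc (suc n) * suc n                 ∎
  where
  open ≡-Reasoning
  lemma : ∀ n → 2 * (1 + n) + (1 + n) * n ≡ (2 + n) * (1 + n)
  lemma = solve-∀

^≡1+t*geometric : ∀ t n → (1 + t) ^ n ≡ 1 + t * geometric (1 + t) n
^≡1+t*geometric t zero    = cong suc (sym (*-zeroʳ t))
^≡1+t*geometric t (suc n) = trans (cong ((1 + t) *_) (^≡1+t*geometric t n)) (lemma t (geometric (1 + t) n))
  where
  lemma : ∀ t g → (1 + t) * (1 + t * g) ≡ 1 + t * (1 + (1 + t) * g)
  lemma = solve-∀

geometric≡n+t*triangular : ∀ t n → ∃[ a ] geometric (1 + t) n ≡ n + t * triangular n + t * t * a
geometric≡n+t*triangular t zero    = 0 , lemma t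
  where
  lemma : ∀ t → 0 ≡ 0 + t * 0 + t * t * 0
  lemma = solve-∀
geometric≡n+t*triangular t (suc n) with geometric≡n+t*triangular t n
... | a , g≡ = a + triangular n + t * a , (begin
  1 + (1 + t) * geometric (1 + t) n                                      ≡⟨ cong (λ g → 1 + (1 + t) * g) g≡ ⟩
  1 + (1 + t) * (n + t * triangular n + t * t * a)                       ≡⟨ lemma t n (triangular n) a ⟩
  (1 + n) + t * (n + triangular n) + t * t * (a + triangular n + t * a)  ∎)
  where
  open ≡-Reasoning
  lemma : ∀ t n T a → 1 + (1 + t) * (n + t * T + t * t * a) ≡ (1 + n) + t * (n + T) + t * t * (a + T + t * a)
  lemma = solve-∀

power-of-2≡2[mod4]⇒≡2 : ∀ {t} → 2 ∣ t → (∀ {q} → Prime q → q ∣ t → q ≡ 2) → 4 ∣ 2 + t → t ≡ 2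
power-of-2≡2[mod4]⇒≡2 (divides 0 refl) _ 4∣2 = contradiction 4∣2 (from-no (4 ∣? 2))
power-of-2≡2[mod4]⇒≡2 (divides 1 refl) _ _   = refl
power-of-2≡2[mod4]⇒≡2 (divides u@(suc (suc _)) refl) only-2 4∣2+t with prime-factor {u} (s≤s (s≤s z≤n))
... | q , q-prime , q∣u with only-2 q-prime (∣-trans q∣u (m∣m*n 2))
...   | refl = contradiction (∣m+n∣m⇒∣n (subst (4 ∣_) (+-comm 2 (u * 2)) 4∣2+t) (*-monoˡ-∣ 2 q∣u))
                             (from-no (4 ∣? 2))

module WithoutPrimeFactor≡1 {φ t : ℕ} (φ-prime : Prime φ) (1≤t : 1 ≤ t)
  (no-prime≡1 : ∀ {q} → Prime q → q ∣ (1 + t) ^ φ ∸ 1 → ¬ φ ∣ q ∸ 1) where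

  private
    instance _ = prime⇒nonZero φ-prime
    G T a : ℕ
    G = geometric (1 + t) φ
    T = triangular φ
    a = proj₁ (geometric≡n+t*triangular t φ)

    G≡t[T+ta]+φ : G ≡ t * (T + t * a) + φ
    G≡t[T+ta]+φ = trans (proj₂ (geometric≡n+t*triangular t φ)) (lemma φ t T a)
      where
      lemma : ∀ φ t T a → φ + t * T + t * t * a ≡ t * (T + t * a) + φ
      lemma = solve-∀

  N≡t*G : (1 + t) ^ φ ∸ 1 ≡ t * G
  N≡t*G = cong (_∸ 1) (^≡1+t*geometric t φ)

  prime∣N⇒∣t : ∀ {q} → Prime q → q ∣ (1 + t) ^ φ ∸ 1 → q ∣ t
  prime∣N⇒∣t q-prime q∣N = ∣x^φ∸1⇒∣x∸1 q-prime (1 + t) φ-prime (no-prime≡1 q-prime q∣N) q∣N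

  -- G ≡ φ (mod t) and every prime factor of G divides t.
  prime∣G⇒≡φ : ∀ {q} → Prime q → q ∣ G → q ≡ φ
  prime∣G⇒≡φ {q} q-prime q∣G with prime⇒irreducible φ-prime q∣φ
    where
    q∣t*[T+ta] : q ∣ t * (T + t * a)
    q∣t*[T+ta] = ∣m⇒∣m*n _ (prime∣N⇒∣t q-prime (∣-trans q∣G (divides t N≡t*G)))
    q∣φ : q ∣ φ
    q∣φ = ∣m+n∣m⇒∣n (subst (q ∣_) G≡t[T+ta]+φ q∣G) q∣t*[T+ta]
  ... | inj₁ refl = contradiction q-prime ¬prime[1]
  ... | inj₂ q≡φ  = q≡φ

  φ<G : φ < G
  φ<G = begin-strict
    φ                    <⟨ m<n+m φ (*-mono-≤ 1≤t (1≤triangular (prime>1 φ-prime))) ⟩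
    t * T + φ            ≤⟨ +-monoˡ-≤ φ (*-monoʳ-≤ t (m≤m+n T (t * a))) ⟩
    t * (T + t * a) + φ  ≡⟨ G≡t[T+ta]+φ ⟨
    G                    ∎
    where open ≤-Reasoning

  φ*φ∣G : φ * φ ∣ G
  φ*φ∣G = prime-power>p⇒p*p∣ φ-prime prime∣G⇒≡φ φ<G

  φ∣t : φ ∣ t
  φ∣t = prime∣N⇒∣t φ-prime (∣-trans (m*n∣⇒m∣ φ φ φ*φ∣G) (divides t N≡t*G))

  -- For odd φ, φ ∣ t and φ ∣ T give G ≡ φ (mod φ * φ).
  φ≡2 : φ ≡ 2
  φ≡2 with φ ≟ 2
  ... | yes φ≡2 = φ≡2
  ... | no  φ≢2 = contradiction (∣⇒≤ φ*φ∣φ) (<⇒≱ (m<m*n φ φ (prime>1 φ-prime)))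
    where
    φ∣T : φ ∣ T
    φ∣T with euclidsLemma 2 T φ-prime (divides (φ ∸ 1) (trans (2*triangular≡n*[n∸1] φ) (*-comm φ (φ ∸ 1))))
    ... | inj₁ φ∣2 = contradiction (≤-antisym (∣⇒≤ φ∣2) (prime>1 φ-prime)) φ≢2
    ... | inj₂ φ∣T = φ∣T
    φ*φ∣φ : φ * φ ∣ φ
    φ*φ∣φ = ∣m+n∣m⇒∣n (subst (φ * φ ∣_) G≡t[T+ta]+φ φ*φ∣G) (*-pres-∣ φ∣t (∣m∣n⇒∣m+n φ∣T (∣m⇒∣m*n a φ∣t)))

no-prime≡1⇒φ≡2∧x≡3 : ∀ {φ x} → Prime φ → 1 < x →
                     (∀ {q} → Prime q → q ∣ x ^ φ ∸ 1 → ¬ φ ∣ q ∸ 1) → φ ≡ 2 × x ≡ 3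
no-prime≡1⇒φ≡2∧x≡3 {x = suc t} φ-prime (s≤s 1≤t) no-prime≡1 with WithoutPrimeFactor≡1.φ≡2 φ-prime 1≤t no-prime≡1
... | refl = refl , cong suc (power-of-2≡2[mod4]⇒≡2 φ∣t only-2 4∣2+t)
  where
  open WithoutPrimeFactor≡1 φ-prime 1≤t no-prime≡1
  only-2 : ∀ {q} → Prime q → q ∣ t → q ≡ 2
  only-2 {q} q-prime q∣t = prime∧2∤[p∸1]⇒p≡2 q-prime (no-prime≡1 q-prime (subst (q ∣_) (sym N≡t*G) (∣m⇒∣m*n _ q∣t)))
  4∣2+t : 4 ∣ 2 + t
  4∣2+t = subst (4 ∣_) (lemma t) φ*φ∣G
    where
    lemma : ∀ t → 1 + (1 + t) * (1 + (1 + t) * 0) ≡ 2 + t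
    lemma = solve-∀

1<x⇒0<x^n∸1 : ∀ {x n} → 1 < x → 0 < n → 0 < x ^ n ∸ 1
1<x⇒0<x^n∸1 {x} 1<x 0<n = m<n⇒0<n∸m (^-monoʳ-< x 1<x 0<n)

Bound : ℕ → ℕ → ℕ → Set
Bound φ x k =
  Σ (Fin k → ℕ) λ r₀ → Σ (Fin (ω (x ^ φ ∸ 1) ∸ k) → ℕ) λ r₁ →
    (∀ i → IsNth (Π⁰? φ) (toℕ i) (r₀ i)) ×
    (∀ j → IsNth (Π¹? φ) (toℕ j) (r₁ j)) ×
    1 + ∏ k r₀ ≤ x ×
    1 + ∏ k r₀ * ∏ (ω (x ^ φ ∸ 1) ∸ k) r₁ ≤ x ^ φ

module _ (φ x : ℕ) where

  primeFactor⁰? : Decidable (PrimeFactorOf (x ^ φ ∸ 1) ∩ Π⁰ φ)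
  primeFactor⁰? = primeFactorOf? (x ^ φ ∸ 1) ∩? Π⁰? φ

  primeFactor¹? : Decidable (PrimeFactorOf (x ^ φ ∸ 1) ∩ Π¹ φ)
  primeFactor¹? = primeFactorOf? (x ^ φ ∸ 1) ∩? Π¹? φ

  ω⁰ ω¹ : ℕ
  ω⁰ = countBelow primeFactor⁰? (suc (x ^ φ ∸ 1))
  ω¹ = countBelow primeFactor¹? (suc (x ^ φ ∸ 1))

  primeFactor-partition : ∀ m → indicator (primeFactorOf? (x ^ φ ∸ 1) m) ≡
                                indicator (primeFactor⁰? m) + indicator (primeFactor¹? m)
  primeFactor-partition m with prime? m | m ∣? (x ^ φ ∸ 1) | φ ∣? (m ∸ 1)
  ... | yes _ | yes _ | yes _ = refl
  ... | yes _ | yes _ | no  _ = refl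
  ... | yes _ | no  _ | yes _ = refl
  ... | yes _ | no  _ | no  _ = refl
  ... | no  _ | _     | yes _ = refl
  ... | no  _ | _     | no  _ = refl

  ω≡ω⁰+ω¹ : ω (x ^ φ ∸ 1) ≡ ω⁰ + ω¹
  ω≡ω⁰+ω¹ = countBelow-partition _ primeFactor⁰? primeFactor¹? primeFactor-partition (suc (x ^ φ ∸ 1))

  ω⁰<ω : 0 < ω¹ → ω⁰ < ω (x ^ φ ∸ 1)
  ω⁰<ω 0<ω¹ = subst (ω⁰ <_) (sym ω≡ω⁰+ω¹) (subst (_≤ ω⁰ + ω¹) (+-comm ω⁰ 1) (+-monoʳ-≤ ω⁰ 0<ω¹))

  ¬0<ω¹⇒no-prime≡1 : Prime φ → 1 < x → ¬ 0 < ω¹ → ∀ {q} → Prime q → q ∣ x ^ φ ∸ 1 → ¬ φ ∣ q ∸ 1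
  ¬0<ω¹⇒no-prime≡1 φ-prime 1<x ω¹≯0 q-prime q∣N φ∣q∸1 =
    ω¹≯0 (countBelow-pos primeFactor¹? ((q-prime , q∣N) , q-prime , φ∣q∸1) (s≤s (∣⇒≤ q∣N)))
    where instance _ = >-nonZero (1<x⇒0<x^n∸1 1<x (<-trans z<s (prime>1 φ-prime)))

  prodBelow⁰∣x∸1 : Prime φ → ∀ n → prodBelow primeFactor⁰? n ∣ x ∸ 1
  prodBelow⁰∣x∸1 φ-prime = prodBelow-∣ primeFactor⁰? (proj₁ ∘ proj₁)
    λ { ((q-prime , q∣N) , _ , φ∤q∸1) → ∣x^φ∸1⇒∣x∸1 q-prime x φ-prime φ∤q∸1 q∣N }

  prodBelow⁰*prodBelow¹∣N : ∀ n → prodBelow primeFactor⁰? n * prodBelow primeFactor¹? n ∣ x ^ φ ∸ 1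
  prodBelow⁰*prodBelow¹∣N n = subst (_∣ x ^ φ ∸ 1)
    (prodBelow-partition _ primeFactor⁰? primeFactor¹? primeFactor-partition n)
    (prodBelow-∣ (primeFactorOf? (x ^ φ ∸ 1)) proj₁ proj₂ n)

  bound-at-ω⁰ : Prime φ → 1 < x → Bound φ x ω⁰
  bound-at-ω⁰ φ-prime 1<x = r₀ , r₁ , r₀-nth , r₁-nth , bound₀ , bound₁
    where
    N B : ℕ
    N = x ^ φ ∸ 1
    B = suc N
    instance
      _ = >-nonZero (1<x⇒0<x^n∸1 1<x (<-trans z<s (prime>1 φ-prime)))
      _ = >-nonZero (m<n⇒0<n∸m 1<x)
    primeFactor≢0 : ∀ {Q : Pred ℕ 0ℓ} {m} → (PrimeFactorOf N ∩ Q) m → NonZero m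
    primeFactor≢0 ((m-prime , _) , _) = prime⇒nonZero m-prime
    ω∸ω⁰≡ω¹ : ω N ∸ ω⁰ ≡ ω¹
    ω∸ω⁰≡ω¹ = trans (cong (_∸ ω⁰) ω≡ω⁰+ω¹) (m+n∸m≡n ω⁰ ω¹)
    ω⁰≤#Π⁰ : ω⁰ ≤ countBelow (Π⁰? φ) B
    ω⁰≤#Π⁰ = countBelow-⊆ primeFactor⁰? (Π⁰? φ) proj₂ B
    ω∸ω⁰≤#Π¹ : ω N ∸ ω⁰ ≤ countBelow (Π¹? φ) B
    ω∸ω⁰≤#Π¹ = subst (_≤ countBelow (Π¹? φ) B) (sym ω∸ω⁰≡ω¹) (countBelow-⊆ primeFactor¹? (Π¹? φ) proj₂ B)
    r₀ : Fin ω⁰ → ℕ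
    r₀ = proj₁ (enumerate (Π⁰? φ) B ω⁰≤#Π⁰)
    r₀-nth : ∀ i → IsNth (Π⁰? φ) (toℕ i) (r₀ i)
    r₀-nth = proj₂ (enumerate (Π⁰? φ) B ω⁰≤#Π⁰)
    r₁ : Fin (ω N ∸ ω⁰) → ℕ
    r₁ = proj₁ (enumerate (Π¹? φ) B ω∸ω⁰≤#Π¹)
    r₁-nth : ∀ j → IsNth (Π¹? φ) (toℕ j) (r₁ j)
    r₁-nth = proj₂ (enumerate (Π¹? φ) B ω∸ω⁰≤#Π¹)
    ∏r₀≤ : ∏ ω⁰ r₀ ≤ prodBelow primeFactor⁰? B
    ∏r₀≤ = ∏-nth≤prodBelow primeFactor⁰? (Π⁰? φ) proj₂ (primeFactor≢0 {Π⁰ φ}) B r₀ r₀-nth ≤-refl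
    ∏r₁≤ : ∏ (ω N ∸ ω⁰) r₁ ≤ prodBelow primeFactor¹? B
    ∏r₁≤ = ∏-nth≤prodBelow primeFactor¹? (Π¹? φ) proj₂ (primeFactor≢0 {Π¹ φ}) B r₁ r₁-nth (≤-reflexive ω∸ω⁰≡ω¹)
    open ≤-Reasoning
    bound₀ : 1 + ∏ ω⁰ r₀ ≤ x
    bound₀ = begin
      1 + ∏ ω⁰ r₀   ≤⟨ s≤s (≤-trans ∏r₀≤ (∣⇒≤ (prodBelow⁰∣x∸1 φ-prime B))) ⟩
      1 + (x ∸ 1)   ≡⟨ m+[n∸m]≡n (<⇒≤ 1<x) ⟩
      x             ∎
    bound₁ : 1 + ∏ ω⁰ r₀ * ∏ (ω N ∸ ω⁰) r₁ ≤ x ^ φ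
    bound₁ = begin
      1 + ∏ ω⁰ r₀ * ∏ (ω N ∸ ω⁰) r₁  ≤⟨ s≤s (≤-trans (*-mono-≤ ∏r₀≤ ∏r₁≤) (∣⇒≤ (prodBelow⁰*prodBelow¹∣N B))) ⟩
      1 + N                         ≡⟨ m+[n∸m]≡n (<⇒≤ (^-monoʳ-< x 1<x (<-trans z<s (prime>1 φ-prime)))) ⟩
      x ^ φ                         ∎

-- The only prime factor 2 of 3 ^ 2 ∸ 1 lies in Π⁰ 2, so k = ω is not admissible; k = 0 works with r₁ = 3.
bound-2-3 : Bound 2 3 0
bound-2-3 = (λ ()) , (λ _ → 3) , (λ ()) , (λ { zero → from-yes (Π¹? 2 3) , refl }) , s≤s (s≤s z≤n) , from-yes (4 ≤? 9)

proposition3p2 : (φ x : ℕ) → Prime φ → 1 < x →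
    ∃[ k ] (k < ω (x ^ φ ∸ 1) ×
      Σ (Fin k → ℕ) λ r₀ → Σ (Fin (ω (x ^ φ ∸ 1) ∸ k) → ℕ) λ r₁ →
        (∀ i → IsNth (Π⁰? φ) (toℕ i) (r₀ i)) ×
        (∀ j → IsNth (Π¹? φ) (toℕ j) (r₁ j)) ×
        1 + ∏ k r₀ ≤ x ×
        1 + ∏ k r₀ * ∏ (ω (x ^ φ ∸ 1) ∸ k) r₁ ≤ x ^ φ)
proposition3p2 φ x φ-prime 1<x with 0 <? ω¹ φ x
... | yes 0<ω¹ = ω⁰ φ x , ω⁰<ω φ x 0<ω¹ , bound-at-ω⁰ φ x φ-prime 1<x
... | no  ω¹≯0 with no-prime≡1⇒φ≡2∧x≡3 φ-prime 1<x (¬0<ω¹⇒no-prime≡1 φ x φ-prime 1<x ω¹≯0)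
...   | refl , refl = 0 , s≤s z≤n , bound-2-3
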